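{- For labeled terms $A,B$, a finite sequence of variables $S$ and $k\ge0$: if $A\Rightarrow_{S,k}B$, then $A\rightsquigarrow_{S,k}B$.
   Context: Labeled terms: $A ::= x \mid \lambda^a x.A \mid A\,@^a A$ with labels from a countably infinite set containing a distinguished never-bound label $\star$; in $A\,@^a B$ the label $a$ binds the occurrences of $a$ in $A$. $A[x:=B]$ is substitution capturing neither variables nor labels; $A[a:=\star]$ replaces free occurrences of $a$ by $\star$. For a context $C$, $\mathrm{bPath}(C)$ is the sequence of variables bound above the hole; a term is away from a sequence $S$ if none of its free variables occur in $S$; $x\cdot S$ prepends, $\oplus$ concatenates. Reduction: $C[(\lambda^a x.A)\,@^a B]\to_S C[A[a:=\star][x:=B]]$ whenever $(\lambda^a x.A)\,@^a B$ is away from $\mathrm{bPath}(C)\oplus S$; $\twoheadrightarrow_S$ is its reflexive–transitive closure. Chain reduction: $A\rightsquigarrow_{S,0}B$ iff $A\twoheadrightarrow_S B$; $A\rightsquigarrow_{S,k+1}B$ iff there exist $x,a,A_1,A_2$ with $A\twoheadrightarrow_S\lambda^a x.A_1$, $A_1\rightsquigarrow_{S,k}A_2$ and $B=\lambda^a x.A_2$. Labeled superstep $\Rightarrow_{S,k}$: $x\Rightarrow_{S,0}x$; $A\Rightarrow_{x\cdot S,0}A'$ gives $\lambda^a x.A\Rightarrow_{S,0}\lambda^a x.A'$; $A\Rightarrow_{S,k}A'$ gives $\lambda^a x.A\Rightarrow_{S,k+1}\lambda^a x.A'$; $A\Rightarrow_{S,0}A'$ and $B\Rightarrow_{S,0}B'$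 give $A\,@^aB\Rightarrow_{S,0}A'\,@^aB'$; if $A\Rightarrow_{S,n+1}\lambda^a x.A'$, $B\Rightarrow_{S,m}B'$, $(\lambda^a x.A')\,@^a B'$ is away from $S$, and ($m>0\Rightarrow A'=\lambda^{a_1}x_1.\cdots\lambda^{a_n}x_n.x$) then $A\,@^aB\Rightarrow_{S,n+m}A'[a:=\star][x:=B']$. -}

module Defs where

-- Labeled λ-terms in de Bruijn representation (both for variables and
-- for labels), i.e. terms are taken modulo α-conversion of variables and
-- of labels.

open import Data.Nat using (ℕ; zero; suc; pred; _+_; _<_; compare; less; equal; greater)
open import Data.List using (List; []; _∷_; map; length)
open import Data.List.Membership.Propositional using (_∉_)
open import Data.Product using (Σ; ∃; _×_; _,_)
open import Relation.Binary.PropositionalEquality using (_≡_)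
open import Relation.Binary.Construct.Closure.ReflexiveTransitive using (Star)

-- Labels: the distinguished never-bound label ⋆, or a label given by a
-- de Bruijn index counting the enclosing *binding* applications
-- (indices beyond the binding depth are free labels).
data Lab : Set where
  ⋆   : Lab
  lab : ℕ → Lab

-- Terms.
--   var i     : variable (de Bruijn index over enclosing λ's)
--   lam a A   : λ^a x. A            (a may be ⋆ or any label)
--   app A B   : A @^a B with a ≠ ⋆  (binds label index 0 inside A only)
--   app⋆ A B  : A @^⋆ B             (binds no label, ⋆ is never bound)
data Term : Set where
  var  : ℕ → Term
  lam  : Lab → Term → Term
  app  : Term → Term → Term
  app⋆ : Term → Term → Term

vshift : ℕ → Term → Term
vshift c (var k) with compare k c
... | less _ _    = var k
... | equal _     = var (suc k)
... | greater _ _ = var (suc k)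
vshift c (lam a A)  = lam a (vshift (suc c) A)
vshift c (app A B)  = app (vshift c A) (vshift c B)
vshift c (app⋆ A B) = app⋆ (vshift c A) (vshift c B)

lshiftLab : ℕ → Lab → Lab
lshiftLab c ⋆ = ⋆
lshiftLab c (lab k) with compare k c
... | less _ _    = lab k
... | equal _     = lab (suc k)
... | greater _ _ = lab (suc k)

lshift : ℕ → Term → Term
lshift c (var k)    = var k
lshift c (lam a A)  = lam (lshiftLab c a) (lshift c A)
lshift c (app A B)  = app (lshift (suc c) A) (lshift c B)
lshift c (app⋆ A B) = app⋆ (lshift c A) (lshift c B)

-- A[a:=⋆] where a is the label with index c: free occurrences of a
-- become ⋆, and the binder of a is removed (higher indices decrease).
starLab : ℕ → Lab → Lab
starLab c ⋆ = ⋆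
starLab c (lab k) with compare k c
... | less _ _    = lab k
... | equal _     = ⋆
... | greater _ _ = lab (pred k)

lstar : ℕ → Term → Term
lstar c (var k)    = var k
lstar c (lam a A)  = lam (starLab c a) (lstar c A)
lstar c (app A B)  = app (lstar (suc c) A) (lstar c B)
lstar c (app⋆ A B) = app⋆ (lstar c A) (lstar c B)

-- B is shifted when going under
-- variable binders (λ) and label binders (labelled @).
sub : ℕ → Term → Term → Term
sub j B (var k) with compare k j
... | less _ _    = var k
... | equal _     = B
... | greater _ _ = var (pred k)
sub j B (lam a A)  = lam a (sub (suc j) (vshift 0 B) A)
sub j B (app A C)  = app (sub j (lshift 0 B) A) (sub j B C)
sub j B (app⋆ A C) = app⋆ (sub j B A) (sub j B C)

-- Contraction of a redex (λ^a x.A) @^a B with body A: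
--   labelled case:  A[a:=⋆][x:=B]
--   ⋆ case:         A[⋆:=⋆][x:=B] = A[x:=B]
contract : Term → Term → Term
contract A B = sub 0 B (lstar 0 A)

contract⋆ : Term → Term → Term
contract⋆ A B = sub 0 B A

data Free : ℕ → Term → Set where
  fvar  : ∀ {k} → Free k (var k)
  flam  : ∀ {k a A} → Free (suc k) A → Free k (lam a A)
  fappˡ : ∀ {k A B} → Free k A → Free k (app A B)
  fappʳ : ∀ {k A B} → Free k B → Free k (app A B)
  fapp⋆ˡ : ∀ {k A B} → Free k A → Free k (app⋆ A B)
  fapp⋆ʳ : ∀ {k A B} → Free k B → Free k (app⋆ A B)

Away : List ℕ → Term → Set
Away S T = ∀ {k} → Free k T → k ∉ S

-- x · S when going under the binder x (the new variable has index 0,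
-- the variables of S are renamed accordingly)
_·_ : ℕ → List ℕ → List ℕ
x · S = x ∷ map suc S

under : List ℕ → List ℕ
under S = map suc S

-- One-step reduction →_S.  Going through a λ^a x adds x to the path
-- bPath(C); this is realised by reducing the body w.r.t. 0 · S.
data _⟶[_]_ : Term → List ℕ → Term → Set where
  β     : ∀ {S A B} → Away S (app (lam (lab 0) A) B) →
          app (lam (lab 0) A) B ⟶[ S ] contract A B
  β⋆    : ∀ {S A B} → Away S (app⋆ (lam ⋆ A) B) →
          app⋆ (lam ⋆ A) B ⟶[ S ] contract⋆ A B
  ξlam  : ∀ {S a A A'} → A ⟶[ 0 · S ] A' → lam a A ⟶[ S ] lam a A'
  ξappˡ : ∀ {S A A' B} → A ⟶[ S ] A' → app A B ⟶[ S ] app A' B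
  ξappʳ : ∀ {S A B B'} → B ⟶[ S ] B' → app A B ⟶[ S ] app A B'
  ξapp⋆ˡ : ∀ {S A A' B} → A ⟶[ S ] A' → app⋆ A B ⟶[ S ] app⋆ A' B
  ξapp⋆ʳ : ∀ {S A B B'} → B ⟶[ S ] B' → app⋆ A B ⟶[ S ] app⋆ A B'

_↠[_]_ : Term → List ℕ → Term → Set
A ↠[ S ] B = Star (λ X Y → X ⟶[ S ] Y) A B

Chain : List ℕ → ℕ → Term → Term → Set
Chain S zero    A B = A ↠[ S ] B
Chain S (suc k) A B =
  Σ Lab λ a → Σ Term λ A₁ → Σ Term λ A₂ →
    (A ↠[ S ] lam a A₁) × Chain (under S) k A₁ A₂ × (B ≡ lam a A₂)

lams : List Lab → Term → Term
lams []       T = T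
lams (a ∷ as) T = lam a (lams as T)

-- A' = λ^{a₁}x₁.⋯λ^{aₙ}xₙ.x where x is the variable bound just outside A'
-- (de Bruijn index n inside the n further binders)
IsProj : ℕ → Term → Set
IsProj n A' = Σ (List Lab) λ as → (length as ≡ n) × (A' ≡ lams as (var n))

data _⇒[_,_]_ : Term → List ℕ → ℕ → Term → Set where
  svar  : ∀ {S i} → var i ⇒[ S , 0 ] var i
  slam₀ : ∀ {S a A A'} → A ⇒[ 0 · S , 0 ] A' → lam a A ⇒[ S , 0 ] lam a A'
  slam  : ∀ {S k a A A'} → A ⇒[ under S , k ] A' →
          lam a A ⇒[ S , suc k ] lam a A'
  sapp  : ∀ {S A A' B B'} → A ⇒[ S , 0 ] A' → B ⇒[ S , 0 ] B' →
          app A B ⇒[ S , 0 ] app A' B'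
  sapp⋆ : ∀ {S A A' B B'} → A ⇒[ S , 0 ] A' → B ⇒[ S , 0 ] B' →
          app⋆ A B ⇒[ S , 0 ] app⋆ A' B'
  sβ    : ∀ {S n m A A' B B'} →
          A ⇒[ S , suc n ] lam (lab 0) A' → B ⇒[ S , m ] B' →
          Away S (app (lam (lab 0) A') B') →
          (0 < m → IsProj n A') →
          app A B ⇒[ S , n + m ] contract A' B'
  sβ⋆   : ∀ {S n m A A' B B'} →
          A ⇒[ S , suc n ] lam ⋆ A' → B ⇒[ S , m ] B' →
          Away S (app⋆ (lam ⋆ A') B') →
          (0 < m → IsProj n A') →
          app⋆ A B ⇒[ S , n + m ] contract⋆ A' B'

-- In a β-superstep the chain A ⇝ λ^a x.A′ starts with A ↠ λ^a x.A₁ where A₁ ⇝ A′ below the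
-- binder.  We contract (λ^a x.A₁) @^a B′ and carry the chain A₁ ⇝ A′ through the contraction:
-- chain reduction is stable under A ↦ A[a:=⋆] and, for a B′ away from the path, under
-- substitution.  The earlier redex is still away from S because reduction relative to S never
-- loses a free variable lying in S.  If B's own superstep has depth m > 0, then A′ is a
-- projection λ^{a₁}x₁.⋯λ^{aₙ}xₙ.x: we contract with the unreduced B instead, reach
-- λ^{a₁}x₁.⋯λ^{aₙ}xₙ.B, and append the depth-m chain of B below the n binders.

module Submission where

open import Defs
open import Data.Nat using (ℕ; zero; suc; pred; _+_; _<_; _≤_; z≤n; s≤s; compare; less; equal; greater)
open import Data.Nat.Properties
open import Data.Empty using (⊥-elim)
open import Function using (id)
open import Relation.Binary.PropositionalEquality
open import Relation.Binary.Definitions using (tri<; tri≈; tri>)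
open import Data.Sum using (inj₁; inj₂)
open import Data.Product using (_×_; _,_; proj₁; proj₂)
open import Data.List using (List; []; _∷_; map; length)
open import Data.List.Properties using (length-map)
open import Relation.Binary.Construct.Closure.ReflexiveTransitive using (ε; _◅_; _◅◅_; gmap)
open import Data.List.Membership.Propositional using (_∈_; _∉_)
open import Data.List.Membership.Propositional.Properties using (∈-map⁺; ∈-map⁻)
open import Data.List.Relation.Unary.Any using (here; there)

private variable
  c d i j k : ℕ
  a : Lab
  A A′ A₁ B B′ X X′ Y Y′ Z : Term
  S T T′ : List ℕ

-- Index arithmetic

vshift-var-< : k < c → vshift c (var k) ≡ var k
vshift-var-< {k} {c} k<c with compare k c
... | less _ _    = refl
... | equal _     = ⊥-elim (n≮n k k<c)
... | greater _ r = ⊥-elim (m+n≮m c r (<⇒≤ k<c))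

vshift-var-≥ : c ≤ k → vshift c (var k) ≡ var (suc k)
vshift-var-≥ {c} {k} c≤k with compare k c
... | less _ r    = ⊥-elim (m+n≮m k r c≤k)
... | equal _     = refl
... | greater _ _ = refl

lshiftLab-< : k < c → lshiftLab c (lab k) ≡ lab k
lshiftLab-< {k} {c} k<c with compare k c
... | less _ _    = refl
... | equal _     = ⊥-elim (n≮n k k<c)
... | greater _ r = ⊥-elim (m+n≮m c r (<⇒≤ k<c))

lshiftLab-≥ : c ≤ k → lshiftLab c (lab k) ≡ lab (suc k)
lshiftLab-≥ {c} {k} c≤k with compare k c
... | less _ r    = ⊥-elim (m+n≮m k r c≤k)
... | equal _     = refl
... | greater _ _ = refl

starLab-< : k < c → starLab c (lab k) ≡ lab k
starLab-< {k} {c} k<c with compare k c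
... | less _ _    = refl
... | equal _     = ⊥-elim (n≮n k k<c)
... | greater _ r = ⊥-elim (m+n≮m c r (<⇒≤ k<c))

starLab-≡ : k ≡ c → starLab c (lab k) ≡ ⋆
starLab-≡ {k} {c} k≡c with compare k c
... | less _ _    = ⊥-elim (m≢1+m+n k k≡c)
... | equal _     = refl
... | greater _ _ = ⊥-elim (m≢1+m+n c (sym k≡c))

starLab-self : ∀ c → starLab c (lab c) ≡ ⋆
starLab-self c = starLab-≡ refl

starLab-> : c < k → starLab c (lab k) ≡ lab (pred k)
starLab-> {c} {k} c<k with compare k c
... | less _ r    = ⊥-elim (m+n≮m k r (<⇒≤ c<k))
... | equal _     = ⊥-elim (n≮n c c<k)
... | greater _ _ = refl

sub-var-< : k < j → sub j B (var k) ≡ var k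
sub-var-< {k} {j} k<j with compare k j
... | less _ _    = refl
... | equal _     = ⊥-elim (n≮n k k<j)
... | greater _ r = ⊥-elim (m+n≮m j r (<⇒≤ k<j))

sub-var-≡ : k ≡ j → sub j B (var k) ≡ B
sub-var-≡ {k} {j} k≡j with compare k j
... | less _ _    = ⊥-elim (m≢1+m+n k k≡j)
... | equal _     = refl
... | greater _ _ = ⊥-elim (m≢1+m+n j (sym k≡j))

sub-var-self : ∀ j B → sub j B (var j) ≡ B
sub-var-self j B = sub-var-≡ refl

sub-var-> : j < k → sub j B (var k) ≡ var (pred k)
sub-var-> {j} {k} j<k with compare k j
... | less _ r    = ⊥-elim (m+n≮m k r (<⇒≤ j<k))
... | equal _     = ⊥-elim (n≮n j j<k)
... | greater _ _ = refl

-- Commutation of the de Bruijn operations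

starLab-lshiftLab-id : ∀ c a → starLab c (lshiftLab c a) ≡ a
starLab-lshiftLab-id c ⋆ = refl
starLab-lshiftLab-id c (lab k) with <-≤-connex k c
... | inj₁ k<c rewrite lshiftLab-< k<c = starLab-< k<c
... | inj₂ c≤k rewrite lshiftLab-≥ c≤k = starLab-> (s≤s c≤k)

lshiftLab-lshiftLab : d ≤ c → ∀ a → lshiftLab (suc c) (lshiftLab d a) ≡ lshiftLab d (lshiftLab c a)
lshiftLab-lshiftLab d≤c ⋆ = refl
lshiftLab-lshiftLab {d} {c} d≤c (lab k) with <-≤-connex k d | <-≤-connex k c
... | inj₁ k<d | _
  rewrite lshiftLab-< k<d | lshiftLab-< (<-≤-trans k<d d≤c)
        | lshiftLab-< (m<n⇒m<1+n (<-≤-trans k<d d≤c)) | lshiftLab-< k<d = refl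
... | inj₂ d≤k | inj₁ k<c
  rewrite lshiftLab-≥ d≤k | lshiftLab-< k<c | lshiftLab-< (s≤s k<c) | lshiftLab-≥ d≤k = refl
... | inj₂ d≤k | inj₂ c≤k
  rewrite lshiftLab-≥ d≤k | lshiftLab-≥ c≤k | lshiftLab-≥ (s≤s c≤k)
        | lshiftLab-≥ (m≤n⇒m≤1+n d≤k) = refl

starLab-lshiftLab : d ≤ c → ∀ a → starLab (suc c) (lshiftLab d a) ≡ lshiftLab d (starLab c a)
starLab-lshiftLab d≤c ⋆ = refl
starLab-lshiftLab {d} {c} d≤c (lab k) with <-≤-connex k d
... | inj₁ k<d
  rewrite lshiftLab-< k<d | starLab-< (<-≤-trans k<d d≤c)
        | starLab-< (m<n⇒m<1+n (<-≤-trans k<d d≤c)) | lshiftLab-< k<d = refl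
... | inj₂ d≤k with <-cmp k c
...   | tri< k<c _ _ rewrite lshiftLab-≥ d≤k | starLab-< k<c | starLab-< (s≤s k<c) | lshiftLab-≥ d≤k = refl
...   | tri≈ _ refl _ rewrite lshiftLab-≥ d≤k | starLab-self k | starLab-self (suc k) = refl
...   | tri> _ _ c<k@(s≤s c≤k′)
  rewrite lshiftLab-≥ d≤k | starLab-> c<k | starLab-> (s≤s c<k) | lshiftLab-≥ (≤-trans d≤c c≤k′) = refl

starLab-starLab : d ≤ c → ∀ a → starLab c (starLab d a) ≡ starLab d (starLab (suc c) a)
starLab-starLab d≤c ⋆ = refl
starLab-starLab {d} {c} d≤c (lab k) with <-cmp k d
... | tri< k<d _ _
  rewrite starLab-< k<d | starLab-< (<-≤-trans k<d d≤c)
        | starLab-< (m<n⇒m<1+n (<-≤-trans k<d d≤c)) | starLab-< k<d = refl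
... | tri≈ _ refl _ rewrite starLab-self k | starLab-< (s≤s d≤c) | starLab-self k = refl
starLab-starLab {d} {c} d≤c (lab (suc k)) | tri> _ _ d<1+k with <-cmp k c
... | tri< k<c _ _ rewrite starLab-> d<1+k | starLab-< k<c | starLab-< (s≤s k<c) | starLab-> d<1+k = refl
... | tri≈ _ refl _ rewrite starLab-> d<1+k | starLab-self k | starLab-self (suc k) = refl
... | tri> _ _ c<k
  rewrite starLab-> d<1+k | starLab-> c<k | starLab-> (s≤s c<k) | starLab-> (≤-<-trans d≤c c<k) = refl

vshift-vshift-var : d ≤ c → ∀ k → vshift (suc c) (vshift d (var k)) ≡ vshift d (vshift c (var k))
vshift-vshift-var {d} {c} d≤c k with <-≤-connex k d | <-≤-connex k c
... | inj₁ k<d | _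
  rewrite vshift-var-< k<d | vshift-var-< (<-≤-trans k<d d≤c)
        | vshift-var-< (m<n⇒m<1+n (<-≤-trans k<d d≤c)) | vshift-var-< k<d = refl
... | inj₂ d≤k | inj₁ k<c
  rewrite vshift-var-≥ d≤k | vshift-var-< k<c | vshift-var-< (s≤s k<c) | vshift-var-≥ d≤k = refl
... | inj₂ d≤k | inj₂ c≤k
  rewrite vshift-var-≥ d≤k | vshift-var-≥ c≤k | vshift-var-≥ (s≤s c≤k)
        | vshift-var-≥ (m≤n⇒m≤1+n d≤k) = refl

sub-vshift-var : ∀ j B k → sub j B (vshift j (var k)) ≡ var k
sub-vshift-var j B k with <-≤-connex k j
... | inj₁ k<j rewrite vshift-var-< k<j = sub-var-< k<j
... | inj₂ j≤k rewrite vshift-var-≥ j≤k = sub-var-> (s≤s j≤k)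

vshift-sub-var-≥ : j ≤ c → ∀ B k → vshift c (sub j B (var k)) ≡ sub j (vshift c B) (vshift (suc c) (var k))
vshift-sub-var-≥ {j} {c} j≤c B k with <-cmp k j
... | tri< k<j _ _
  rewrite sub-var-< {B = B} k<j | vshift-var-< (<-≤-trans k<j j≤c)
        | vshift-var-< (m<n⇒m<1+n (<-≤-trans k<j j≤c)) | sub-var-< {B = vshift c B} k<j = refl
... | tri≈ _ refl _
  rewrite sub-var-self k B | vshift-var-< (s≤s j≤c) | sub-var-self k (vshift c B) = refl
vshift-sub-var-≥ {j} {c} j≤c B (suc k) | tri> _ _ j<1+k with <-≤-connex k c
... | inj₁ k<c
  rewrite sub-var-> {B = B} j<1+k | vshift-var-< k<c | vshift-var-< (s≤s k<c)
        | sub-var-> {B = vshift c B} j<1+k = refl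
... | inj₂ c≤k
  rewrite sub-var-> {B = B} j<1+k | vshift-var-≥ c≤k | vshift-var-≥ (s≤s c≤k)
        | sub-var-> {B = vshift c B} (m<n⇒m<1+n j<1+k) = refl

vshift-sub-var-≤ : c ≤ j → ∀ B k → vshift c (sub j B (var k)) ≡ sub (suc j) (vshift c B) (vshift c (var k))
vshift-sub-var-≤ {c} {j} c≤j B k with <-cmp k j
... | tri≈ _ refl _
  rewrite sub-var-self k B | vshift-var-≥ c≤j | sub-var-self (suc k) (vshift c B) = refl
vshift-sub-var-≤ {c} {j} c≤j B (suc k) | tri> _ _ j<1+k
  rewrite sub-var-> {B = B} j<1+k | vshift-var-≥ (≤-trans c≤j (≤-pred j<1+k))
        | vshift-var-≥ (m≤n⇒m≤1+n (≤-trans c≤j (≤-pred j<1+k))) | sub-var-> {B = vshift c B} (s≤s j<1+k) = refl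
... | tri< k<j _ _ with <-≤-connex k c
...   | inj₁ k<c
  rewrite sub-var-< {B = B} k<j | vshift-var-< k<c | sub-var-< {B = vshift c B} (m<n⇒m<1+n k<j) = refl
...   | inj₂ c≤k
  rewrite sub-var-< {B = B} k<j | vshift-var-≥ c≤k | sub-var-< {B = vshift c B} (s≤s k<j) = refl

lstar-lshift-id : ∀ c X → lstar c (lshift c X) ≡ X
lstar-lshift-id c (var k)    = refl
lstar-lshift-id c (lam a X)  = cong₂ lam (starLab-lshiftLab-id c a) (lstar-lshift-id c X)
lstar-lshift-id c (app X Y)  = cong₂ app (lstar-lshift-id (suc c) X) (lstar-lshift-id c Y)
lstar-lshift-id c (app⋆ X Y) = cong₂ app⋆ (lstar-lshift-id c X) (lstar-lshift-id c Y)

lstar-vshift : ∀ c d X → lstar c (vshift d X) ≡ vshift d (lstar c X)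
lstar-vshift c d (var k) with compare k d
... | less _ _    = refl
... | equal _     = refl
... | greater _ _ = refl
lstar-vshift c d (lam a X)  = cong (lam _) (lstar-vshift c (suc d) X)
lstar-vshift c d (app X Y)  = cong₂ app (lstar-vshift (suc c) d X) (lstar-vshift c d Y)
lstar-vshift c d (app⋆ X Y) = cong₂ app⋆ (lstar-vshift c d X) (lstar-vshift c d Y)

lshift-vshift : ∀ c d X → lshift c (vshift d X) ≡ vshift d (lshift c X)
lshift-vshift c d (var k) with compare k d
... | less _ _    = refl
... | equal _     = refl
... | greater _ _ = refl
lshift-vshift c d (lam a X)  = cong (lam _) (lshift-vshift c (suc d) X)
lshift-vshift c d (app X Y)  = cong₂ app (lshift-vshift (suc c) d X) (lshift-vshift c d Y)
lshift-vshift c d (app⋆ X Y) = cong₂ app⋆ (lshift-vshift c d X) (lshift-vshift c d Y)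

lstar-lstar : d ≤ c → ∀ X → lstar c (lstar d X) ≡ lstar d (lstar (suc c) X)
lstar-lstar d≤c (var k)    = refl
lstar-lstar d≤c (lam a X)  = cong₂ lam (starLab-starLab d≤c a) (lstar-lstar d≤c X)
lstar-lstar d≤c (app X Y)  = cong₂ app (lstar-lstar (s≤s d≤c) X) (lstar-lstar d≤c Y)
lstar-lstar d≤c (app⋆ X Y) = cong₂ app⋆ (lstar-lstar d≤c X) (lstar-lstar d≤c Y)

lstar-lshift : d ≤ c → ∀ X → lstar (suc c) (lshift d X) ≡ lshift d (lstar c X)
lstar-lshift d≤c (var k)    = refl
lstar-lshift d≤c (lam a X)  = cong₂ lam (starLab-lshiftLab d≤c a) (lstar-lshift d≤c X)
lstar-lshift d≤c (app X Y)  = cong₂ app (lstar-lshift (s≤s d≤c) X) (lstar-lshift d≤c Y)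
lstar-lshift d≤c (app⋆ X Y) = cong₂ app⋆ (lstar-lshift d≤c X) (lstar-lshift d≤c Y)

lshift-lshift : d ≤ c → ∀ X → lshift (suc c) (lshift d X) ≡ lshift d (lshift c X)
lshift-lshift d≤c (var k)    = refl
lshift-lshift d≤c (lam a X)  = cong₂ lam (lshiftLab-lshiftLab d≤c a) (lshift-lshift d≤c X)
lshift-lshift d≤c (app X Y)  = cong₂ app (lshift-lshift (s≤s d≤c) X) (lshift-lshift d≤c Y)
lshift-lshift d≤c (app⋆ X Y) = cong₂ app⋆ (lshift-lshift d≤c X) (lshift-lshift d≤c Y)

vshift-vshift : d ≤ c → ∀ X → vshift (suc c) (vshift d X) ≡ vshift d (vshift c X)
vshift-vshift d≤c (var k)    = vshift-vshift-var d≤c k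
vshift-vshift d≤c (lam a X)  = cong (lam a) (vshift-vshift (s≤s d≤c) X)
vshift-vshift d≤c (app X Y)  = cong₂ app (vshift-vshift d≤c X) (vshift-vshift d≤c Y)
vshift-vshift d≤c (app⋆ X Y) = cong₂ app⋆ (vshift-vshift d≤c X) (vshift-vshift d≤c Y)

lstar-sub : ∀ c j B X → lstar c (sub j B X) ≡ sub j (lstar c B) (lstar c X)
lstar-sub c j B (var k) with compare k j
... | less _ _    = refl
... | equal _     = refl
... | greater _ _ = refl
lstar-sub c j B (lam a X) =
  cong (lam _) (trans (lstar-sub c (suc j) (vshift 0 B) X)
                      (cong (λ B′ → sub (suc j) B′ (lstar c X)) (lstar-vshift c 0 B)))
lstar-sub c j B (app X Y) =
  cong₂ app (trans (lstar-sub (suc c) j (lshift 0 B) X)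
                   (cong (λ B′ → sub j B′ (lstar (suc c) X)) (lstar-lshift z≤n B)))
            (lstar-sub c j B Y)
lstar-sub c j B (app⋆ X Y) = cong₂ app⋆ (lstar-sub c j B X) (lstar-sub c j B Y)

lshift-sub : ∀ c j B X → lshift c (sub j B X) ≡ sub j (lshift c B) (lshift c X)
lshift-sub c j B (var k) with compare k j
... | less _ _    = refl
... | equal _     = refl
... | greater _ _ = refl
lshift-sub c j B (lam a X) =
  cong (lam _) (trans (lshift-sub c (suc j) (vshift 0 B) X)
                      (cong (λ B′ → sub (suc j) B′ (lshift c X)) (lshift-vshift c 0 B)))
lshift-sub c j B (app X Y) =
  cong₂ app (trans (lshift-sub (suc c) j (lshift 0 B) X)
                   (cong (λ B′ → sub j B′ (lshift (suc c) X)) (lshift-lshift z≤n B)))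
            (lshift-sub c j B Y)
lshift-sub c j B (app⋆ X Y) = cong₂ app⋆ (lshift-sub c j B X) (lshift-sub c j B Y)

sub-vshift-id : ∀ j B X → sub j B (vshift j X) ≡ X
sub-vshift-id j B (var k)    = sub-vshift-var j B k
sub-vshift-id j B (lam a X)  = cong (lam a) (sub-vshift-id (suc j) (vshift 0 B) X)
sub-vshift-id j B (app X Y)  = cong₂ app (sub-vshift-id j (lshift 0 B) X) (sub-vshift-id j B Y)
sub-vshift-id j B (app⋆ X Y) = cong₂ app⋆ (sub-vshift-id j B X) (sub-vshift-id j B Y)

vshift-sub-≥ : j ≤ c → ∀ B X → vshift c (sub j B X) ≡ sub j (vshift c B) (vshift (suc c) X)
vshift-sub-≥ j≤c B (var k) = vshift-sub-var-≥ j≤c B k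
vshift-sub-≥ {j} {c} j≤c B (lam a X) =
  cong (lam a) (trans (vshift-sub-≥ (s≤s j≤c) (vshift 0 B) X)
                      (cong (λ B′ → sub (suc j) B′ (vshift (suc (suc c)) X)) (vshift-vshift z≤n B)))
vshift-sub-≥ {j} {c} j≤c B (app X Y) =
  cong₂ app (trans (vshift-sub-≥ j≤c (lshift 0 B) X)
                   (cong (λ B′ → sub j B′ (vshift (suc c) X)) (sym (lshift-vshift 0 c B))))
            (vshift-sub-≥ j≤c B Y)
vshift-sub-≥ j≤c B (app⋆ X Y) = cong₂ app⋆ (vshift-sub-≥ j≤c B X) (vshift-sub-≥ j≤c B Y)

vshift-sub-≤ : c ≤ j → ∀ B X → vshift c (sub j B X) ≡ sub (suc j) (vshift c B) (vshift c X)
vshift-sub-≤ c≤j B (var k) = vshift-sub-var-≤ c≤j B k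
vshift-sub-≤ {c} {j} c≤j B (lam a X) =
  cong (lam a) (trans (vshift-sub-≤ (s≤s c≤j) (vshift 0 B) X)
                      (cong (λ B′ → sub (suc (suc j)) B′ (vshift (suc c) X)) (vshift-vshift z≤n B)))
vshift-sub-≤ {c} {j} c≤j B (app X Y) =
  cong₂ app (trans (vshift-sub-≤ c≤j (lshift 0 B) X)
                   (cong (λ B′ → sub (suc j) B′ (vshift c X)) (sym (lshift-vshift 0 c B))))
            (vshift-sub-≤ c≤j B Y)
vshift-sub-≤ c≤j B (app⋆ X Y) = cong₂ app⋆ (vshift-sub-≤ c≤j B X) (vshift-sub-≤ c≤j B Y)

sub-sub-var : i ≤ j → ∀ B C k →
  sub j B (sub i C (var k)) ≡ sub i (sub j B C) (sub (suc j) (vshift i B) (var k))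
sub-sub-var {i} {j} i≤j B C k with <-cmp k i
... | tri< k<i _ _
  rewrite sub-var-< {B = C} k<i | sub-var-< {B = B} (<-≤-trans k<i i≤j)
        | sub-var-< {B = vshift i B} (m<n⇒m<1+n (<-≤-trans k<i i≤j)) | sub-var-< {B = sub j B C} k<i = refl
... | tri≈ _ refl _
  rewrite sub-var-self k C | sub-var-< {B = vshift k B} (s≤s i≤j) | sub-var-self k (sub j B C) = refl
sub-sub-var {i} {j} i≤j B C (suc k) | tri> _ _ i<1+k with <-cmp k j
... | tri< k<j _ _
  rewrite sub-var-> {B = C} i<1+k | sub-var-< {B = B} k<j | sub-var-< {B = vshift i B} (s≤s k<j)
        | sub-var-> {B = sub j B C} i<1+k = refl
... | tri≈ _ refl _
  rewrite sub-var-> {B = C} i<1+k | sub-var-self k B | sub-var-self (suc k) (vshift i B)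
        | sub-vshift-id i (sub k B C) B = refl
sub-sub-var {i} {j} i≤j B C (suc (suc k)) | tri> _ _ i<2+k | tri> _ _ j<1+k
  rewrite sub-var-> {B = C} i<2+k | sub-var-> {B = B} j<1+k | sub-var-> {B = vshift i B} (s≤s j<1+k)
        | sub-var-> {B = sub j B C} (≤-<-trans i≤j j<1+k) = refl

sub-sub : i ≤ j → ∀ B C X → sub j B (sub i C X) ≡ sub i (sub j B C) (sub (suc j) (vshift i B) X)
sub-sub i≤j B C (var k) = sub-sub-var i≤j B C k
sub-sub {i} {j} i≤j B C (lam a X) =
  cong (lam a) (trans (sub-sub (s≤s i≤j) (vshift 0 B) (vshift 0 C) X)
                      (cong₂ (λ C′ B′ → sub (suc i) C′ (sub (suc (suc j)) B′ X))
                             (sym (vshift-sub-≤ z≤n B C)) (vshift-vshift z≤n B)))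
sub-sub {i} {j} i≤j B C (app X Y) =
  cong₂ app (trans (sub-sub i≤j (lshift 0 B) (lshift 0 C) X)
                   (cong₂ (λ C′ B′ → sub i C′ (sub (suc j) B′ X))
                          (sym (lshift-sub 0 j B C)) (sym (lshift-vshift 0 i B))))
            (sub-sub i≤j B C Y)
sub-sub i≤j B C (app⋆ X Y) = cong₂ app⋆ (sub-sub i≤j B C X) (sub-sub i≤j B C Y)

lstar-contract : ∀ c A B → lstar c (contract A B) ≡ contract (lstar (suc c) A) (lstar c B)
lstar-contract c A B = begin
  lstar c (sub 0 B (lstar 0 A))               ≡⟨ lstar-sub c 0 B (lstar 0 A) ⟩
  sub 0 (lstar c B) (lstar c (lstar 0 A))     ≡⟨ cong (sub 0 (lstar c B)) (lstar-lstar z≤n A) ⟩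
  sub 0 (lstar c B) (lstar 0 (lstar (suc c) A)) ∎
  where open ≡-Reasoning

sub-contract : ∀ j B A C →
  sub j B (contract A C) ≡ contract (sub (suc j) (vshift 0 (lshift 0 B)) A) (sub j B C)
sub-contract j B A C = begin
  sub j B (sub 0 C (lstar 0 A))
    ≡⟨ sub-sub z≤n B C (lstar 0 A) ⟩
  sub 0 (sub j B C) (sub (suc j) (vshift 0 B) (lstar 0 A))
    ≡⟨ cong (λ B′ → sub 0 (sub j B C) (sub (suc j) B′ (lstar 0 A))) (sym weaken-lshift) ⟩
  sub 0 (sub j B C) (sub (suc j) (lstar 0 (vshift 0 (lshift 0 B))) (lstar 0 A))
    ≡⟨ cong (sub 0 (sub j B C)) (sym (lstar-sub 0 (suc j) _ A)) ⟩
  sub 0 (sub j B C) (lstar 0 (sub (suc j) (vshift 0 (lshift 0 B)) A)) ∎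
  where
  open ≡-Reasoning
  weaken-lshift : lstar 0 (vshift 0 (lshift 0 B)) ≡ vshift 0 B
  weaken-lshift = trans (lstar-vshift 0 0 (lshift 0 B)) (cong (vshift 0) (lstar-lshift-id 0 B))

vshift-contract : ∀ c A C → vshift c (contract A C) ≡ contract (vshift (suc c) A) (vshift c C)
vshift-contract c A C = begin
  vshift c (sub 0 C (lstar 0 A))
    ≡⟨ vshift-sub-≥ z≤n C (lstar 0 A) ⟩
  sub 0 (vshift c C) (vshift (suc c) (lstar 0 A))
    ≡⟨ cong (sub 0 (vshift c C)) (sym (lstar-vshift 0 (suc c) A)) ⟩
  sub 0 (vshift c C) (lstar 0 (vshift (suc c) A)) ∎
  where open ≡-Reasoning

weakenⁿ : ℕ → Term → Term
weakenⁿ zero    X = X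
weakenⁿ (suc n) X = weakenⁿ n (vshift 0 X)

projection : List Lab → Term
projection as = lams as (var (length as))

lstar-lams : ∀ c as X → lstar c (lams as X) ≡ lams (map (starLab c) as) (lstar c X)
lstar-lams c []       X = refl
lstar-lams c (a ∷ as) X = cong (lam (starLab c a)) (lstar-lams c as X)

sub-lams-var : ∀ bs j B → sub j B (lams bs (var (length bs + j))) ≡ lams bs (weakenⁿ (length bs) B)
sub-lams-var []       j B = sub-var-self j B
sub-lams-var (b ∷ bs) j B =
  cong (lam b) (trans (cong (λ i → sub (suc j) (vshift 0 B) (lams bs (var i)))
                            (sym (+-suc (length bs) j)))
                      (sub-lams-var bs (suc j) (vshift 0 B)))

contract⋆-projection : ∀ as B → contract⋆ (projection as) B ≡ lams as (weakenⁿ (length as) B)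
contract⋆-projection as B =
  trans (cong (λ i → sub 0 B (lams as (var i))) (sym (+-identityʳ (length as)))) (sub-lams-var as 0 B)

contract-projection : ∀ as B →
  contract (projection as) B ≡ lams (map (starLab 0) as) (weakenⁿ (length as) B)
contract-projection as B = begin
  sub 0 B (lstar 0 (lams as (var L)))
    ≡⟨ cong (sub 0 B) (lstar-lams 0 as (var L)) ⟩
  contract⋆ (lams as′ (var L)) B
    ≡⟨ cong (λ i → contract⋆ (lams as′ (var i)) B) (sym (length-map _ as)) ⟩
  contract⋆ (projection as′) B
    ≡⟨ contract⋆-projection as′ B ⟩
  lams as′ (weakenⁿ (length as′) B)
    ≡⟨ cong (λ i → lams as′ (weakenⁿ i B)) (length-map _ as) ⟩
  lams as′ (weakenⁿ L B) ∎
  where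
  open ≡-Reasoning
  L = length as
  as′ = map (starLab 0) as

-- Free variables and paths

∈-under⁺ : k ∈ T → suc k ∈ under T
∈-under⁺ = ∈-map⁺ suc

∈-under⁻ : suc k ∈ under T → k ∈ T
∈-under⁻ k∈ with ∈-map⁻ suc k∈
... | _ , k∈T , refl = k∈T

0∉under : 0 ∉ under T
0∉under 0∈ with ∈-map⁻ suc 0∈
... | _ , _ , ()

free-lstar⁻ : ∀ c X → Free k (lstar c X) → Free k X
free-lstar⁻ c (var j)    f          = f
free-lstar⁻ c (lam a X)  (flam f)   = flam (free-lstar⁻ c X f)
free-lstar⁻ c (app X Y)  (fappˡ f)  = fappˡ (free-lstar⁻ (suc c) X f)
free-lstar⁻ c (app X Y)  (fappʳ f)  = fappʳ (free-lstar⁻ c Y f)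
free-lstar⁻ c (app⋆ X Y) (fapp⋆ˡ f) = fapp⋆ˡ (free-lstar⁻ c X f)
free-lstar⁻ c (app⋆ X Y) (fapp⋆ʳ f) = fapp⋆ʳ (free-lstar⁻ c Y f)

free-lshift⁻ : ∀ c X → Free k (lshift c X) → Free k X
free-lshift⁻ c (var j)    f          = f
free-lshift⁻ c (lam a X)  (flam f)   = flam (free-lshift⁻ c X f)
free-lshift⁻ c (app X Y)  (fappˡ f)  = fappˡ (free-lshift⁻ (suc c) X f)
free-lshift⁻ c (app X Y)  (fappʳ f)  = fappʳ (free-lshift⁻ c Y f)
free-lshift⁻ c (app⋆ X Y) (fapp⋆ˡ f) = fapp⋆ˡ (free-lshift⁻ c X f)
free-lshift⁻ c (app⋆ X Y) (fapp⋆ʳ f) = fapp⋆ʳ (free-lshift⁻ c Y f)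

free-var⁻ : Free k (var j) → k ≡ j
free-var⁻ fvar = refl

data ShiftSource (c : ℕ) (X : Term) : ℕ → Set where
  below : k < c → Free k X → ShiftSource c X k
  above : c ≤ k → Free k X → ShiftSource c X (suc k)

ShiftSource-map : (∀ {k} → Free k X → Free k Y) → ShiftSource c X k → ShiftSource c Y k
ShiftSource-map g (below k<c f) = below k<c (g f)
ShiftSource-map g (above c≤k f) = above c≤k (g f)

free-vshift⁻ : ∀ c X → Free k (vshift c X) → ShiftSource c X k
free-vshift⁻ c (var j) f with <-≤-connex j c
... | inj₁ j<c rewrite vshift-var-< j<c | free-var⁻ f = below j<c fvar
... | inj₂ c≤j rewrite vshift-var-≥ c≤j | free-var⁻ f = above c≤j fvar
free-vshift⁻ c (lam a X) (flam f) with free-vshift⁻ (suc c) X f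
... | below (s≤s k<c) f′ = below k<c (flam f′)
... | above (s≤s c≤k) f′ = above c≤k (flam f′)
free-vshift⁻ c (app X Y)  (fappˡ f)  = ShiftSource-map fappˡ (free-vshift⁻ c X f)
free-vshift⁻ c (app X Y)  (fappʳ f)  = ShiftSource-map fappʳ (free-vshift⁻ c Y f)
free-vshift⁻ c (app⋆ X Y) (fapp⋆ˡ f) = ShiftSource-map fapp⋆ˡ (free-vshift⁻ c X f)
free-vshift⁻ c (app⋆ X Y) (fapp⋆ʳ f) = ShiftSource-map fapp⋆ʳ (free-vshift⁻ c Y f)

data SubSource (j : ℕ) (B X : Term) (k : ℕ) : Set where
  below : k < j → Free k X → SubSource j B X k
  above : j ≤ k → Free (suc k) X → SubSource j B X k
  inside : Free k B → SubSource j B X k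

SubSource-map : (∀ {k} → Free k B → Free k B′) → (∀ {k} → Free k X → Free k Y) →
                SubSource j B X k → SubSource j B′ Y k
SubSource-map g h (below k<j f) = below k<j (h f)
SubSource-map g h (above j≤k f) = above j≤k (h f)
SubSource-map g h (inside f)    = inside (g f)

free-sub⁻ : ∀ j B X → Free k (sub j B X) → SubSource j B X k
free-sub⁻ j B (var i) f with <-cmp i j
... | tri< i<j _ _ rewrite sub-var-< {B = B} i<j | free-var⁻ f = below i<j fvar
... | tri≈ _ refl _ rewrite sub-var-self i B = inside f
free-sub⁻ j B (var (suc i)) f | tri> _ _ j<1+i
  rewrite sub-var-> {B = B} j<1+i | free-var⁻ f = above (≤-pred j<1+i) fvar
free-sub⁻ j B (lam a X) (flam f) with free-sub⁻ (suc j) (vshift 0 B) X f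
... | below (s≤s k<j) f′ = below k<j (flam f′)
... | above (s≤s j≤k) f′ = above j≤k (flam f′)
... | inside f′ with free-vshift⁻ 0 B f′
...   | above _ f″ = inside f″
free-sub⁻ j B (app X Y)  (fappˡ f)  = SubSource-map (free-lshift⁻ 0 B) fappˡ (free-sub⁻ j (lshift 0 B) X f)
free-sub⁻ j B (app X Y)  (fappʳ f)  = SubSource-map id fappʳ (free-sub⁻ j B Y f)
free-sub⁻ j B (app⋆ X Y) (fapp⋆ˡ f) = SubSource-map id fapp⋆ˡ (free-sub⁻ j B X f)
free-sub⁻ j B (app⋆ X Y) (fapp⋆ʳ f) = SubSource-map id fapp⋆ʳ (free-sub⁻ j B Y f)

PreservesFree : List ℕ → Term → Term → Set
PreservesFree T X Y = ∀ {k} → Free k X → k ∈ T → Free k Y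

PreservesFree-refl : PreservesFree T X X
PreservesFree-refl f _ = f

away-reflect : PreservesFree T X Y → Away T Y → Away T X
away-reflect p aw f k∈ = aw (p f k∈) k∈

lam-preserves-free : PreservesFree (under T) X Y → PreservesFree T (lam a X) (lam a Y)
lam-preserves-free p (flam f) k∈ = flam (p f (∈-under⁺ k∈))

app-preserves-free : PreservesFree T X X′ → PreservesFree T Y Y′ → PreservesFree T (app X Y) (app X′ Y′)
app-preserves-free p q (fappˡ f) k∈ = fappˡ (p f k∈)
app-preserves-free p q (fappʳ f) k∈ = fappʳ (q f k∈)

app⋆-preserves-free : PreservesFree T X X′ → PreservesFree T Y Y′ → PreservesFree T (app⋆ X Y) (app⋆ X′ Y′)
app⋆-preserves-free p q (fapp⋆ˡ f) k∈ = fapp⋆ˡ (p f k∈)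
app⋆-preserves-free p q (fapp⋆ʳ f) k∈ = fapp⋆ʳ (q f k∈)

-- T′ can serve as the path for vshift c X whenever T serves for X: a free variable of
-- vshift c X lies in T′ only if the variable of X it comes from lies in T.  SubPath is the
-- same for sub j B X, whose remaining free variables come from B.
ShiftPath : ℕ → List ℕ → List ℕ → Set
ShiftPath c T T′ = ∀ {k} → (k < c → k ∈ T′ → k ∈ T) × (c ≤ k → suc k ∈ T′ → k ∈ T)

SubPath : ℕ → List ℕ → List ℕ → Set
SubPath j T T′ = ∀ {k} → (k < j → k ∈ T′ → k ∈ T) × (j ≤ k → k ∈ T′ → suc k ∈ T)

shiftPath-under : ShiftPath 0 T (under T)
shiftPath-under = (λ ()) , λ _ → ∈-under⁻

shiftPath-0· : ShiftPath 0 T (0 · T)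
shiftPath-0· = (λ ()) , λ { _ (here ()) ; _ (there k∈) → ∈-under⁻ k∈ }

shiftPath-suc-under : ShiftPath c T T′ → ShiftPath (suc c) (under T) (under T′)
shiftPath-suc-under {c} {T} {T′} p = lower , upper
  where
  lower : k < suc c → k ∈ under T′ → k ∈ under T
  lower {zero}  _         0∈ = ⊥-elim (0∉under 0∈)
  lower {suc k} (s≤s k<c) k∈ = ∈-under⁺ (proj₁ p k<c (∈-under⁻ k∈))
  upper : suc c ≤ k → suc k ∈ under T′ → k ∈ under T
  upper {suc k} (s≤s c≤k) k∈ = ∈-under⁺ (proj₂ p c≤k (∈-under⁻ k∈))

shiftPath-suc-∷0 : ShiftPath (suc c) T T′ → ShiftPath (suc c) (0 ∷ T) (0 ∷ T′)
shiftPath-suc-∷0 {c} {T} {T′} p = lower , upper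
  where
  lower : k < suc c → k ∈ 0 ∷ T′ → k ∈ 0 ∷ T
  lower _   (here refl) = here refl
  lower k<c (there k∈)  = there (proj₁ p k<c k∈)
  upper : suc c ≤ k → suc k ∈ 0 ∷ T′ → k ∈ 0 ∷ T
  upper c≤k (there k∈) = there (proj₂ p c≤k k∈)

subPath-under : SubPath 0 (under T) T
subPath-under = (λ ()) , λ _ → ∈-under⁺

subPath-suc-under : SubPath j T T′ → SubPath (suc j) (under T) (under T′)
subPath-suc-under {j} {T} {T′} p = lower , upper
  where
  lower : k < suc j → k ∈ under T′ → k ∈ under T
  lower {zero}  _         0∈ = ⊥-elim (0∉under 0∈)
  lower {suc k} (s≤s k<j) k∈ = ∈-under⁺ (proj₁ p k<j (∈-under⁻ k∈))
  upper : suc j ≤ k → k ∈ under T′ → suc k ∈ under T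
  upper {suc k} (s≤s j≤k) k∈ = ∈-under⁺ (proj₂ p j≤k (∈-under⁻ k∈))

subPath-suc-∷0 : SubPath (suc j) T T′ → SubPath (suc j) (0 ∷ T) (0 ∷ T′)
subPath-suc-∷0 {j} {T} {T′} p = lower , upper
  where
  lower : k < suc j → k ∈ 0 ∷ T′ → k ∈ 0 ∷ T
  lower _   (here refl) = here refl
  lower k<j (there k∈)  = there (proj₁ p k<j k∈)
  upper : suc j ≤ k → k ∈ 0 ∷ T′ → suc k ∈ 0 ∷ T
  upper () (here refl)
  upper j≤k (there k∈) = there (proj₂ p j≤k k∈)

away-lstar : ∀ c → Away T X → Away T (lstar c X)
away-lstar c aw f = aw (free-lstar⁻ c _ f)

away-lshift : ∀ c → Away T X → Away T (lshift c X)
away-lshift c aw f = aw (free-lshift⁻ c _ f)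

away-vshift : ShiftPath c T T′ → Away T X → Away T′ (vshift c X)
away-vshift p aw f k∈ with free-vshift⁻ _ _ f
... | below k<c f′ = aw f′ (proj₁ p k<c k∈)
... | above c≤k f′ = aw f′ (proj₂ p c≤k k∈)

away-sub : SubPath j T T′ → Away T′ B → Away T X → Away T′ (sub j B X)
away-sub p awB aw f k∈ with free-sub⁻ _ _ _ f
... | below k<j f′ = aw f′ (proj₁ p k<j k∈)
... | above j≤k f′ = aw f′ (proj₂ p j≤k k∈)
... | inside f′    = awB f′ k∈

-- Stability of reduction

step-to : Y ≡ Z → X ⟶[ T ] Y → X ⟶[ T ] Z
step-to refl r = r

step-lstar : ∀ c → X ⟶[ T ] Y → lstar c X ⟶[ T ] lstar c Y
step-lstar c (β {A = A} {B} aw) =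
  step-to (sym (lstar-contract c A B)) (β (away-lstar c aw))
step-lstar c (β⋆ {A = A} {B} aw) =
  step-to (sym (lstar-sub c 0 B A)) (β⋆ (away-lstar c aw))
step-lstar c (ξlam r)   = ξlam (step-lstar c r)
step-lstar c (ξappˡ r)  = ξappˡ (step-lstar (suc c) r)
step-lstar c (ξappʳ r)  = ξappʳ (step-lstar c r)
step-lstar c (ξapp⋆ˡ r) = ξapp⋆ˡ (step-lstar c r)
step-lstar c (ξapp⋆ʳ r) = ξapp⋆ʳ (step-lstar c r)

step-sub : SubPath j T T′ → Away T′ B → X ⟶[ T ] Y → sub j B X ⟶[ T′ ] sub j B Y
step-sub {j} {B = B} p awB (β {A = A} {C} aw) =
  step-to (sym (sub-contract j B A C)) (β (away-sub p awB aw))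
step-sub {j} {B = B} p awB (β⋆ {A = A} {C} aw) =
  step-to (sym (sub-sub z≤n B C A)) (β⋆ (away-sub p awB aw))
step-sub p awB (ξlam r)   =
  ξlam (step-sub (subPath-suc-∷0 (subPath-suc-under p)) (away-vshift shiftPath-0· awB) r)
step-sub p awB (ξappˡ r)  = ξappˡ (step-sub p (away-lshift 0 awB) r)
step-sub p awB (ξappʳ r)  = ξappʳ (step-sub p awB r)
step-sub p awB (ξapp⋆ˡ r) = ξapp⋆ˡ (step-sub p awB r)
step-sub p awB (ξapp⋆ʳ r) = ξapp⋆ʳ (step-sub p awB r)

step-vshift : ShiftPath c T T′ → X ⟶[ T ] Y → vshift c X ⟶[ T′ ] vshift c Y
step-vshift {c} p (β {A = A} {C} aw) =
  step-to (sym (vshift-contract c A C)) (β (away-vshift p aw))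
step-vshift {c} p (β⋆ {A = A} {C} aw) =
  step-to (sym (vshift-sub-≥ z≤n C A)) (β⋆ (away-vshift p aw))
step-vshift p (ξlam r)   = ξlam (step-vshift (shiftPath-suc-∷0 (shiftPath-suc-under p)) r)
step-vshift p (ξappˡ r)  = ξappˡ (step-vshift p r)
step-vshift p (ξappʳ r)  = ξappʳ (step-vshift p r)
step-vshift p (ξapp⋆ˡ r) = ξapp⋆ˡ (step-vshift p r)
step-vshift p (ξapp⋆ʳ r) = ξapp⋆ʳ (step-vshift p r)

step-preserves-free : X ⟶[ T ] Y → PreservesFree T X Y
step-preserves-free (β aw)     f k∈ = ⊥-elim (aw f k∈)
step-preserves-free (β⋆ aw)    f k∈ = ⊥-elim (aw f k∈)
step-preserves-free (ξlam r)   (flam f) k∈ = flam (step-preserves-free r f (there (∈-under⁺ k∈)))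
step-preserves-free (ξappˡ r)  = app-preserves-free (step-preserves-free r) PreservesFree-refl
step-preserves-free (ξappʳ r)  = app-preserves-free PreservesFree-refl (step-preserves-free r)
step-preserves-free (ξapp⋆ˡ r) = app⋆-preserves-free (step-preserves-free r) PreservesFree-refl
step-preserves-free (ξapp⋆ʳ r) = app⋆-preserves-free PreservesFree-refl (step-preserves-free r)

steps-lstar : ∀ c → X ↠[ T ] Y → lstar c X ↠[ T ] lstar c Y
steps-lstar c = gmap (lstar c) (step-lstar c)

steps-sub : SubPath j T T′ → Away T′ B → X ↠[ T ] Y → sub j B X ↠[ T′ ] sub j B Y
steps-sub {j} {B = B} p awB = gmap (sub j B) (step-sub p awB)

steps-vshift : ShiftPath c T T′ → X ↠[ T ] Y → vshift c X ↠[ T′ ] vshift c Y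
steps-vshift {c} p = gmap (vshift c) (step-vshift p)

steps-lam : X ↠[ 0 · T ] Y → lam a X ↠[ T ] lam a Y
steps-lam {a = a} = gmap (lam a) ξlam

steps-app : X ↠[ T ] X′ → Y ↠[ T ] Y′ → app X Y ↠[ T ] app X′ Y′
steps-app {X′ = X′} {Y = Y} X↠ Y↠ =
  gmap (λ Z → app Z Y) ξappˡ X↠ ◅◅ gmap (app X′) ξappʳ Y↠

steps-app⋆ : X ↠[ T ] X′ → Y ↠[ T ] Y′ → app⋆ X Y ↠[ T ] app⋆ X′ Y′
steps-app⋆ {X′ = X′} {Y = Y} X↠ Y↠ =
  gmap (λ Z → app⋆ Z Y) ξapp⋆ˡ X↠ ◅◅ gmap (app⋆ X′) ξapp⋆ʳ Y↠

steps-preserve-free : X ↠[ T ] Y → PreservesFree T X Y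
steps-preserve-free ε        f k∈ = f
steps-preserve-free (r ◅ rs) f k∈ = steps-preserve-free rs (step-preserves-free r f k∈) k∈

-- Chains

chain-lstar : ∀ n c → Chain T n X Y → Chain T n (lstar c X) (lstar c Y)
chain-lstar zero    c X↠ = steps-lstar c X↠
chain-lstar (suc n) c (a , X₁ , Y₁ , X↠ , ch , refl) =
  starLab c a , lstar c X₁ , lstar c Y₁ , steps-lstar c X↠ , chain-lstar n c ch , refl

chain-sub : ∀ n → SubPath j T T′ → Away T′ B → Chain T n X Y → Chain T′ n (sub j B X) (sub j B Y)
chain-sub zero    p awB X↠ = steps-sub p awB X↠
chain-sub {j = j} {B = B} (suc n) p awB (a , X₁ , Y₁ , X↠ , ch , refl) =
  a , sub (suc j) (vshift 0 B) X₁ , sub (suc j) (vshift 0 B) Y₁ , steps-sub p awB X↠ ,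
  chain-sub n (subPath-suc-under p) (away-vshift shiftPath-under awB) ch , refl

chain-vshift : ∀ n → ShiftPath c T T′ → Chain T n X Y → Chain T′ n (vshift c X) (vshift c Y)
chain-vshift zero    p X↠ = steps-vshift p X↠
chain-vshift {c = c} (suc n) p (a , X₁ , Y₁ , X↠ , ch , refl) =
  a , vshift (suc c) X₁ , vshift (suc c) Y₁ , steps-vshift p X↠ ,
  chain-vshift n (shiftPath-suc-under p) ch , refl

chain-preserves-free : ∀ n → Chain T n X Y → PreservesFree T X Y
chain-preserves-free zero    X↠ = steps-preserve-free X↠
chain-preserves-free (suc n) (_ , _ , _ , X↠ , ch , refl) f k∈ =
  lam-preserves-free (chain-preserves-free n ch) (steps-preserve-free X↠ f k∈) k∈

underⁿ : ℕ → List ℕ → List ℕ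
underⁿ zero    T = T
underⁿ (suc n) T = underⁿ n (under T)

chain-weakenⁿ : ∀ ℓ m → Chain T m X Y → Chain (underⁿ ℓ T) m (weakenⁿ ℓ X) (weakenⁿ ℓ Y)
chain-weakenⁿ zero    m ch = ch
chain-weakenⁿ (suc ℓ) m ch = chain-weakenⁿ ℓ m (chain-vshift m shiftPath-under ch)

chain-prepend : ∀ n → X ↠[ T ] X′ → Chain T n X′ Y → Chain T n X Y
chain-prepend zero    X↠ ch = X↠ ◅◅ ch
chain-prepend (suc n) X↠ (a , X₁ , Y₁ , X′↠ , ch , eq) = a , X₁ , Y₁ , X↠ ◅◅ X′↠ , ch , eq

chain-lams : ∀ m bs {ℓ} → length bs ≡ ℓ →
  Chain T ℓ X (lams bs Y) → Chain (underⁿ ℓ T) m Y Z → Chain T (ℓ + m) X (lams bs Z)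
chain-lams m []       refl X↠ ch = chain-prepend m X↠ ch
chain-lams m (b ∷ bs) refl (a , X₁ , _ , X↠ , ch₁ , refl) ch =
  b , X₁ , _ , X↠ , chain-lams m bs refl ch₁ ch , refl

chain-contract : ∀ n → Away S B → Chain (under S) n A₁ A′ → Chain S n (contract A₁ B) (contract A′ B)
chain-contract n awB ch = chain-sub n subPath-under awB (chain-lstar n 0 ch)

chain-contract⋆ : ∀ n → Away S B → Chain (under S) n A₁ A′ → Chain S n (contract⋆ A₁ B) (contract⋆ A′ B)
chain-contract⋆ n awB ch = chain-sub n subPath-under awB ch

redex-away : ∀ n → Chain (under S) n A₁ A′ → PreservesFree S B B′ →
  Away S (app (lam a A′) B′) → Away S (app (lam a A₁) B)
redex-away n ch B-free =
  away-reflect (app-preserves-free (lam-preserves-free (chain-preserves-free n ch)) B-free)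

redex⋆-away : ∀ n → Chain (under S) n A₁ A′ → PreservesFree S B B′ →
  Away S (app⋆ (lam a A′) B′) → Away S (app⋆ (lam a A₁) B)
redex⋆-away n ch B-free =
  away-reflect (app⋆-preserves-free (lam-preserves-free (chain-preserves-free n ch)) B-free)

chain-β : ∀ {S A A′ B B′} n → Chain S (suc n) A (lam (lab 0) A′) → B ↠[ S ] B′ →
  Away S (app (lam (lab 0) A′) B′) → Chain S n (app A B) (contract A′ B′)
chain-β n (_ , A₁ , _ , A↠ , ch , refl) B↠ aw =
  chain-prepend n (steps-app A↠ B↠ ◅◅ β (redex-away n ch PreservesFree-refl aw) ◅ ε)
    (chain-contract n (λ f → aw (fappʳ f)) ch)

chain-β⋆ : ∀ {S A A′ B B′} n → Chain S (suc n) A (lam ⋆ A′) → B ↠[ S ] B′ →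
  Away S (app⋆ (lam ⋆ A′) B′) → Chain S n (app⋆ A B) (contract⋆ A′ B′)
chain-β⋆ n (_ , A₁ , _ , A↠ , ch , refl) B↠ aw =
  chain-prepend n (steps-app⋆ A↠ B↠ ◅◅ β⋆ (redex⋆-away n ch PreservesFree-refl aw) ◅ ε)
    (chain-contract⋆ n (λ f → aw (fapp⋆ʳ f)) ch)

chain-β-projection : ∀ {S A B B′} as m → Chain S (suc (length as)) A (lam (lab 0) (projection as)) →
  Chain S (suc m) B B′ → Away S (app (lam (lab 0) (projection as)) B′) →
  Chain S (length as + suc m) (app A B) (contract (projection as) B′)
chain-β-projection {S} {A} {B} {B′} as m (_ , A₁ , _ , A↠ , ch , refl) B⇝ aw =
  subst (Chain S (L + suc m) (app A B)) (sym (contract-projection as B′))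
    (chain-lams (suc m) (map (starLab 0) as) (length-map _ as)
      (chain-prepend L (steps-app A↠ ε ◅◅ β (redex-away L ch B-free aw) ◅ ε)
        (subst (Chain S L (contract A₁ B)) (contract-projection as B) (chain-contract L awB ch)))
      (chain-weakenⁿ L (suc m) B⇝))
  where
  L = length as
  B-free : PreservesFree S B B′
  B-free = chain-preserves-free (suc m) B⇝
  awB : Away S B
  awB = away-reflect B-free (λ f → aw (fappʳ f))

chain-β⋆-projection : ∀ {S A B B′} as m → Chain S (suc (length as)) A (lam ⋆ (projection as)) →
  Chain S (suc m) B B′ → Away S (app⋆ (lam ⋆ (projection as)) B′) →
  Chain S (length as + suc m) (app⋆ A B) (contract⋆ (projection as) B′)
chain-β⋆-projection {S} {A} {B} {B′} as m (_ , A₁ , _ , A↠ , ch , refl) B⇝ aw =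
  subst (Chain S (L + suc m) (app⋆ A B)) (sym (contract⋆-projection as B′))
    (chain-lams (suc m) as refl
      (chain-prepend L (steps-app⋆ A↠ ε ◅◅ β⋆ (redex⋆-away L ch B-free aw) ◅ ε)
        (subst (Chain S L (contract⋆ A₁ B)) (contract⋆-projection as B) (chain-contract⋆ L awB ch)))
      (chain-weakenⁿ L (suc m) B⇝))
  where
  L = length as
  B-free : PreservesFree S B B′
  B-free = chain-preserves-free (suc m) B⇝
  awB : Away S B
  awB = away-reflect B-free (λ f → aw (fapp⋆ʳ f))

superstep⇒chain : A ⇒[ S , k ] B → Chain S k A B
superstep⇒chain svar          = ε
superstep⇒chain (slam₀ d)     = steps-lam (superstep⇒chain d)
superstep⇒chain (slam {a = a} {A} {A′} d) = a , A , A′ , ε , superstep⇒chain d , refl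
superstep⇒chain (sapp d e)    = steps-app (superstep⇒chain d) (superstep⇒chain e)
superstep⇒chain (sapp⋆ d e)   = steps-app⋆ (superstep⇒chain d) (superstep⇒chain e)
superstep⇒chain {S = S} (sβ {n = n} {zero} d e aw _) =
  subst (λ k → Chain S k _ _) (sym (+-identityʳ n))
    (chain-β n (superstep⇒chain d) (superstep⇒chain e) aw)
superstep⇒chain (sβ {m = suc m} d e aw isProjection) with isProjection (s≤s z≤n)
... | as , refl , refl = chain-β-projection as m (superstep⇒chain d) (superstep⇒chain e) aw
superstep⇒chain {S = S} (sβ⋆ {n = n} {zero} d e aw _) =
  subst (λ k → Chain S k _ _) (sym (+-identityʳ n))
    (chain-β⋆ n (superstep⇒chain d) (superstep⇒chain e) aw)
superstep⇒chain (sβ⋆ {m = suc m} d e aw isProjection) with isProjection (s≤s z≤n)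
... | as , refl , refl = chain-β⋆-projection as m (superstep⇒chain d) (superstep⇒chain e) aw

mainTheorem10 : (S : List ℕ) (k : ℕ) (A B : Term) →
    A ⇒[ S , k ] B → Chain S k A B
mainTheorem10 S k A B = superstep⇒chain
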